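{- Let $T$ be the generalized triangle, i.e. the $3$-graph with vertex set $\{v_1,v_2,v_3,v_4,v_5\}$ and edge set $\{\{v_1,v_2,v_3\},\{v_1,v_2,v_4\},\{v_3,v_4,v_5\}\}$. For $n\ge 5$, $$c_2(n,T)=\begin{cases}1, & n\in[5,10],\\ 2, & n\ge 11 \text{ and } n-1\equiv 0 \pmod 3,\\ 1, & n\ge 11 \text{ and } n-1\equiv 1 \text{ or } 2 \pmod 3.\end{cases}$$
   Context: A $3$-graph $G=(V,E)$ has $E$ a family of $3$-element subsets of $V$. For $S\subseteq V$, $d_G(S)$ is the number of edges containing $S$; for $i\in\{1,2\}$ the minimum $i$-degree $\delta_i(G)$ is the minimum of $d_G(S)$ over all $i$-subsets $S$ of $V$. For a $3$-graph $F$, $G$ has an $F$-covering if every vertex of $G$ lies in some copy of $F$ in $G$ (a subgraph isomorphic to $F$). $c_i(n,F)$ is the maximum of $\delta_i(G)$ over all $n$-vertex $3$-graphs $G$ that have no $F$-covering. -}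

module Defs where

open import Data.Nat using (ℕ; _≤_; _%_; _∸_; _≤ᵇ_; _≡ᵇ_)
open import Data.Nat.ListAction using (sum)
open import Data.Bool using (Bool; true; false; if_then_else_)
open import Data.Fin using (Fin) renaming (zero to f0; suc to fs)
open import Data.List using (map)
open import Data.List.Base using (allFin)
open import Data.Product using (Σ; ∃; _×_)
open import Relation.Binary.PropositionalEquality using (_≡_; _≢_)
open import Relation.Nullary using (¬_)
open import Function.Definitions using (Injective)

-- A 3-graph on vertex set Fin n: a symmetric edge indicator on triples,
-- which is false on triples with a repeated vertex.  The edges are the
-- 3-sets {x,y,z} with edge x y z ≡ true.
record ThreeGraph (n : ℕ) : Set where
  field
    edge      : Fin n → Fin n → Fin n → Bool
    sym₁₂     : ∀ x y z → edge x y z ≡ edge y x z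
    sym₂₃     : ∀ x y z → edge x y z ≡ edge x z y
    loopless  : ∀ x z → edge x x z ≡ false
open ThreeGraph public

codeg : ∀ {n} → ThreeGraph n → Fin n → Fin n → ℕ
codeg {n} G x y = sum (map (λ z → if edge G x y z then 1 else 0) (allFin n))

MinCodeg : ∀ {n} → ThreeGraph n → ℕ → Set
MinCodeg {n} G c =
  (∀ (x y : Fin n) → x ≢ y → c ≤ codeg G x y) ×
  Σ (Fin n) (λ x → Σ (Fin n) (λ y → x ≢ y × codeg G x y ≡ c))

v₁ v₂ v₃ v₄ v₅ : Fin 5
v₁ = f0
v₂ = fs f0
v₃ = fs (fs f0)
v₄ = fs (fs (fs f0))
v₅ = fs (fs (fs (fs f0)))

IsCopyOfT : ∀ {n} → ThreeGraph n → (Fin 5 → Fin n) → Set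
IsCopyOfT G f =
  Injective _≡_ _≡_ f ×
  edge G (f v₁) (f v₂) (f v₃) ≡ true ×
  edge G (f v₁) (f v₂) (f v₄) ≡ true ×
  edge G (f v₃) (f v₄) (f v₅) ≡ true

HasTCovering : ∀ {n} → ThreeGraph n → Set
HasTCovering {n} G =
  ∀ (v : Fin n) → Σ (Fin 5 → Fin n) (λ f → IsCopyOfT G f × Σ (Fin 5) (λ i → f i ≡ v))

IsC2T : ℕ → ℕ → Set
IsC2T n c =
  Σ (ThreeGraph n) (λ G → ¬ HasTCovering G × MinCodeg G c) ×
  (∀ (G : ThreeGraph n) (d : ℕ) → ¬ HasTCovering G → MinCodeg G d → d ≤ c)

c2Value : ℕ → ℕ
c2Value n with n ≤ᵇ 10
... | true  = 1
... | false = if (((n ∸ 1) % 3) ≡ᵇ 0) then 2 else 1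

{-# OPTIONS --safe #-}
module Submission where

-- Let δ₂(G) ≥ 2 and let v lie in no copy of T. For u ≠ v and two link vertices a, b
-- of {v, u}, every edge {a, b, w} has w ∈ {v, u}, since otherwise {v,u,a}, {v,u,b}, {a,b,w} is a
-- copy of T through v. Hence the link graph of v is a disjoint union of triangles covering all
-- vertices but v, so every codegree d(v, u) is 2 and 3 ∣ n − 1. For d ∉ {v, u, a, b}, two link
-- vertices x, y of {u, d} give four vertices u, d, x, y in different triangles (an edge {v, x, y}
-- would complete the copy {u,d,x}, {u,d,y}, {x,y,v} of T), so n ≥ 13.
--
-- The star of all triples through one vertex has δ₂ = 1 and contains no T: its edges
-- {v₁,v₂,v₃} and {v₃,v₄,v₅} meet only in v₃, which must then be the centre, and likewise v₄.
-- For n = 3k + 1 with k ≥ 4, take an apex and k blocks of three vertices coloured 0, 1, 2;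
-- the edges are the blocks, the apex with two vertices of a block, and the triples from three
-- different blocks whose colours sum to 0 mod 3. All codegrees are at least 2, and a copy of T
-- through the apex would put four of its vertices into one block, or give two of its vertices
-- in one block the same colour.

open import Defs
open import Data.Nat using (ℕ; _≤_)
import Data.Nat as ℕ
open import Data.Nat using (zero; suc; _+_; _*_; _∸_; _<_; z≤n; s≤s; _≤?_; _≤ᵇ_; _≡ᵇ_; _%_)
open import Data.Nat.Properties
  using ( module ≤-Reasoning; +-*-semiring; ≤-refl; ≤-reflexive; ≤-trans; ≤-antisym; <-irrefl; <⇒≱; ≰⇒>
        ; +-mono-≤; *-monoʳ-≤; *-cancelʳ-<; +-comm; +-assoc; *-comm; *-identityʳ; *-zeroʳ
        ; n≤1+n; m∸n≤m; m+n∸m≡n; ≤ᵇ⇒≤; ≤⇒≤ᵇ; ≡ᵇ⇒≡ )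
open import Data.Nat.DivMod using (m*n%n≡0)
open import Data.Nat.Divisibility using (divides; m%n≡0⇒n∣m)
open import Data.Nat.ListAction using () renaming (sum to listSum)
open import Data.Bool using (true; false; if_then_else_; T)
import Data.Bool as Bool
open import Data.Unit using (tt)
open import Data.Empty using (⊥; ⊥-elim)
open import Data.Product using (Σ; ∃; ∃₂; _×_; _,_; proj₁; proj₂)
open import Data.Sum using (_⊎_; inj₁; inj₂; [_,_]′)
open import Data.Fin using (Fin; toℕ; combine; quotient; remainder; punchIn) renaming (suc to sucF)
import Data.Fin as Fin
open import Data.Fin.Patterns using (0F; 1F; 2F; 3F; 4F)
open import Data.Fin.Properties
  using ( _≟_; any?; all?; suc-injective; injective⇒≤; punchIn-injective
        ; remQuot-combine; combine-remQuot; combine-injective )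
import Data.Fin.Properties as Fin
open import Data.List using (List; []; _∷_; length)
import Data.List as List
open import Data.List.Properties using (length-map; map-tabulate)
open import Data.List.Membership.Propositional using (_∈_; _∉_)
open import Data.List.Membership.Propositional.Properties using (∈-lookup)
open import Data.List.Relation.Unary.Any using (here; there)
import Data.List.Relation.Unary.Any as Any
open import Data.List.Relation.Unary.All as All using (All; []; _∷_)
import Data.List.Relation.Unary.All.Properties as All
open import Data.List.Relation.Unary.AllPairs using (AllPairs; []; _∷_)
open import Data.List.Relation.Unary.Unique.Propositional using (Unique)
open import Function using (_∘_; id)
open import Function.Bundles using (mk⇔)
open import Function.Definitions using (Injective)
open import Relation.Nullary using (¬_; Dec; yes; no; does; contradiction)
open import Relation.Nullary.Decidable
  using (_×-dec_; _⊎-dec_; _→-dec_; ¬?; toSum; from-yes; does-⇔; dec-true; dec-false; decidable-stable)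
open import Relation.Unary using (Pred; Decidable; _⊆_)
open import Relation.Unary.Properties using (_∪?_; _∩?_; ∁?; U?)
open import Relation.Binary.PropositionalEquality
  using (_≡_; _≢_; refl; sym; trans; cong; cong₂; subst; module ≡-Reasoning)
open import Algebra.Properties.Semiring.Sum +-*-semiring
  using (sum; sum-syntax; sum-cong-≗; ∑-distrib-+; ∑-comm; *-distribˡ-sum)

module _ {n : ℕ} where
  open import Data.List.Membership.DecPropositional (_≟_ {n}) public using (_∈?_)

-- Counting in Fin n

indicator : ∀ {a} {A : Set a} → Dec A → ℕ
indicator a? = if does a? then 1 else 0

count : ∀ {n p} {P : Pred (Fin n) p} → Decidable P → ℕ
count {n} P? = ∑[ i < n ] indicator (P? i)

∑-mono-≤ : ∀ {n} {f g : Fin n → ℕ} → (∀ i → f i ≤ g i) → sum f ≤ sum g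
∑-mono-≤ {zero}  _   = z≤n
∑-mono-≤ {suc n} f≤g = +-mono-≤ (f≤g 0F) (∑-mono-≤ (f≤g ∘ sucF))

module _ {a b} {A : Set a} {B : Set b} where

  indicator-mono : (A → B) → (a? : Dec A) (b? : Dec B) → indicator a? ≤ indicator b?
  indicator-mono A⇒B (yes a) (yes _) = ≤-refl
  indicator-mono A⇒B (yes a) (no ¬b) = contradiction (A⇒B a) ¬b
  indicator-mono A⇒B (no _)  _       = z≤n

  indicator-⊎ : (a? : Dec A) (b? : Dec B) → indicator (a? ⊎-dec b?) ≤ indicator a? + indicator b?
  indicator-⊎ (yes _) _ = s≤s z≤n
  indicator-⊎ (no _)  _ = ≤-refl

  indicator-⊎-disjoint : ¬ (A × B) → (a? : Dec A) (b? : Dec B) →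
                         indicator (a? ⊎-dec b?) ≡ indicator a? + indicator b?
  indicator-⊎-disjoint ¬a×b (yes a) (yes b) = contradiction (a , b) ¬a×b
  indicator-⊎-disjoint ¬a×b (yes _) (no _)  = refl
  indicator-⊎-disjoint ¬a×b (no _)  _       = refl

module _ {n p q} {P : Pred (Fin n) p} {Q : Pred (Fin n) q} (P? : Decidable P) (Q? : Decidable Q) where

  count-mono : P ⊆ Q → count P? ≤ count Q?
  count-mono P⊆Q = ∑-mono-≤ (λ i → indicator-mono P⊆Q (P? i) (Q? i))

  count-∪-≤ : count (P? ∪? Q?) ≤ count P? + count Q?
  count-∪-≤ = ≤-trans (∑-mono-≤ (λ i → indicator-⊎ (P? i) (Q? i)))
                      (≤-reflexive (∑-distrib-+ (indicator ∘ P?) (indicator ∘ Q?)))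

  count-∪-disjoint : (∀ {i} → P i → Q i → ⊥) → count (P? ∪? Q?) ≡ count P? + count Q?
  count-∪-disjoint disjoint =
    trans (sum-cong-≗ (λ i → indicator-⊎-disjoint (λ (p , q) → disjoint p q) (P? i) (Q? i)))
          (∑-distrib-+ (indicator ∘ P?) (indicator ∘ Q?))

count-cong : ∀ {n p q} {P : Pred (Fin n) p} {Q : Pred (Fin n) q} (P? : Decidable P) (Q? : Decidable Q) →
             P ⊆ Q → Q ⊆ P → count P? ≡ count Q?
count-cong P? Q? P⊆Q Q⊆P = ≤-antisym (count-mono P? Q? P⊆Q) (count-mono Q? P? Q⊆P)

count-none : ∀ {n p} {P : Pred (Fin n) p} (P? : Decidable P) → (∀ i → ¬ P i) → count P? ≡ 0
count-none {zero}  P? ¬P = refl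
count-none {suc n} P? ¬P with P? 0F
... | yes P0 = contradiction P0 (¬P 0F)
... | no _   = count-none (P? ∘ sucF) (¬P ∘ sucF)

count-all : ∀ {n p} {P : Pred (Fin n) p} (P? : Decidable P) → (∀ i → P i) → count P? ≡ n
count-all {zero}  P? allP = refl
count-all {suc n} P? allP with P? 0F
... | yes _  = cong suc (count-all (P? ∘ sucF) (allP ∘ sucF))
... | no ¬P0 = contradiction (allP 0F) ¬P0

count-unique : ∀ {n p} {P : Pred (Fin n) p} (P? : Decidable P) {a : Fin n} →
               P a → (∀ {w} → P w → w ≡ a) → count P? ≡ 1
count-unique {suc n} P? {0F} Pa unique with P? 0F
... | yes _  = cong suc (count-none (P? ∘ sucF) (λ i Pi → contradiction (unique Pi) λ ()))
... | no ¬P0 = contradiction Pa ¬P0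
count-unique {suc n} P? {sucF a} Pa unique with P? 0F
... | yes P0 = contradiction (unique P0) λ ()
... | no _   = count-unique (P? ∘ sucF) Pa (suc-injective ∘ unique)

module _ {n : ℕ} where

  count-∈ : (xs : List (Fin n)) → count (_∈? xs) ≤ length xs
  count-∈ []       = ≤-reflexive (count-none {n} (_∈? []) (λ _ ()))
  count-∈ (x ∷ xs) = begin
    count (_∈? x ∷ xs)              ≡⟨ count-cong (_∈? x ∷ xs) ((_≟ x) ∪? (_∈? xs)) Any.toSum Any.fromSum ⟩
    count ((_≟ x) ∪? (_∈? xs))      ≤⟨ count-∪-≤ (_≟ x) (_∈? xs) ⟩
    count (_≟ x) + count (_∈? xs)   ≤⟨ +-mono-≤ (≤-reflexive (count-unique (_≟ x) refl id)) (count-∈ xs) ⟩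
    suc (length xs)                 ∎
    where open ≤-Reasoning

  count-∈-unique : {xs : List (Fin n)} → Unique xs → count (_∈? xs) ≡ length xs
  count-∈-unique {[]}     []           = count-none {n} (_∈? []) (λ _ ())
  count-∈-unique {x ∷ xs} (x∉xs ∷ uxs) = begin
    count (_∈? x ∷ xs)              ≡⟨ count-cong (_∈? x ∷ xs) ((_≟ x) ∪? (_∈? xs)) Any.toSum Any.fromSum ⟩
    count ((_≟ x) ∪? (_∈? xs))      ≡⟨ count-∪-disjoint (_≟ x) (_∈? xs) (λ { refl x∈xs → All.lookup x∉xs x∈xs refl }) ⟩
    count (_≟ x) + count (_∈? xs)   ≡⟨ cong₂ _+_ (count-unique (_≟ x) refl id) (count-∈-unique uxs) ⟩
    suc (length xs)                 ∎
    where open ≡-Reasoning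

  module _ {p} {P : Pred (Fin n) p} (P? : Decidable P) where

    length≤count : {xs : List (Fin n)} → Unique xs → All P xs → length xs ≤ count P?
    length≤count {xs} uxs Pxs = begin
      length xs       ≡⟨ count-∈-unique uxs ⟨
      count (_∈? xs)  ≤⟨ count-mono (_∈? xs) P? (All.lookup Pxs) ⟩
      count P?        ∎
      where open ≤-Reasoning

    count≤length : {xs : List (Fin n)} → P ⊆ (_∈ xs) → count P? ≤ length xs
    count≤length {xs} P⊆xs = ≤-trans (count-mono P? (_∈? xs) P⊆xs) (count-∈ xs)

    length<count⇒∃∉ : (xs : List (Fin n)) → length xs < count P? → ∃ λ z → P z × z ∉ xs
    length<count⇒∃∉ xs xs<P with any? (P? ∩? ∁? (_∈? xs))
    ... | yes found = found
    ... | no ¬found = contradiction (count≤length P⊆xs) (<⇒≱ xs<P)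
      where
      P⊆xs : P ⊆ (_∈ xs)
      P⊆xs {z} Pz = decidable-stable (z ∈? xs) (λ z∉xs → ¬found (z , Pz , z∉xs))

  length<n⇒∃∉ : (xs : List (Fin n)) → length xs < n → ∃ λ z → z ∉ xs
  length<n⇒∃∉ xs xs<n
    with z , _ , z∉xs ← length<count⇒∃∉ U? xs (subst (length xs <_) (sym (count-all U? _)) xs<n) = z , z∉xs

  count-≢ : (v : Fin n) → count (∁? (_≟ v)) ≡ n ∸ 1
  count-≢ v = begin
    count (∁? (_≟ v))                     ≡⟨ m+n∸m≡n 1 _ ⟨
    suc (count (∁? (_≟ v))) ∸ 1           ≡⟨ cong (λ c → c + count (∁? (_≟ v)) ∸ 1) (count-unique (_≟ v) refl id) ⟨
    count (_≟ v) + count (∁? (_≟ v)) ∸ 1  ≡⟨ cong (_∸ 1) (count-∪-disjoint (_≟ v) (∁? (_≟ v)) (λ u≡v u≢v → u≢v u≡v)) ⟨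
    count v-or-not ∸ 1                    ≡⟨ cong (_∸ 1) (count-all v-or-not (λ u → toSum (u ≟ v))) ⟩
    n ∸ 1                                 ∎
    where
    open ≡-Reasoning
    v-or-not : Decidable (λ u → u ≡ v ⊎ u ≢ v)
    v-or-not = (_≟ v) ∪? ∁? (_≟ v)

listSum-tabulate : ∀ {n} (f : Fin n → ℕ) → listSum (List.tabulate f) ≡ ∑[ i < n ] f i
listSum-tabulate {zero}  f = refl
listSum-tabulate {suc n} f = cong (f 0F +_) (listSum-tabulate (f ∘ sucF))

lookup-injective : ∀ {a} {A : Set a} {xs : List A} → Unique xs → Injective _≡_ _≡_ (List.lookup xs)
lookup-injective (x∉xs ∷ uxs) {0F}     {0F}     _     = refl
lookup-injective (x∉xs ∷ uxs) {0F}     {sucF j} x≡xⱼ  = contradiction x≡xⱼ (All.lookup x∉xs (∈-lookup j))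
lookup-injective (x∉xs ∷ uxs) {sucF i} {0F}     xᵢ≡x  = contradiction (sym xᵢ≡x) (All.lookup x∉xs (∈-lookup i))
lookup-injective (x∉xs ∷ uxs) {sucF i} {sucF j} xᵢ≡xⱼ = cong sucF (lookup-injective uxs xᵢ≡xⱼ)

unique-length≡n⇒∈ : ∀ {n} {xs : List (Fin n)} → Unique xs → length xs ≡ n → ∀ y → y ∈ xs
unique-length≡n⇒∈ {xs = xs} uxs xs≡n y = decidable-stable (y ∈? xs) λ y∉xs →
  <-irrefl xs≡n (injective⇒≤ (lookup-injective {xs = y ∷ xs} (All.¬Any⇒All¬ xs y∉xs ∷ uxs)))

-- Classes of a partial equivalence relation

least : ∀ {n p} {P : Pred (Fin n) p} (P? : Decidable P) {a : Fin n} →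
        P a → ∃ λ ℓ → P ℓ × (∀ {z} → P z → ℓ Fin.≤ z)
least {suc n} P? Pa with P? 0F
... | yes P0 = 0F , P0 , λ _ → z≤n
least {suc n} P? {0F}     P0 | no ¬P0 = contradiction P0 ¬P0
least {suc n} P? {sucF a} Pa | no ¬P0 with ℓ , Pℓ , min ← least (P? ∘ sucF) Pa =
  sucF ℓ , Pℓ , λ { {0F} P0 → contradiction P0 ¬P0 ; {sucF z} Pz → s≤s (min Pz) }

module PartialEquivalence {n ℓ} {_~_ : Fin n → Fin n → Set ℓ}
  (~-sym : ∀ {u w} → u ~ w → w ~ u) (~-trans : ∀ {u w x} → u ~ w → w ~ x → u ~ x)
  (_~?_ : ∀ u w → Dec (u ~ w)) where

  Leader : Pred (Fin n) ℓ
  Leader w = w ~ w × (∀ z → z ~ w → w Fin.≤ z)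

  leader? : Decidable Leader
  leader? w = (w ~? w) ×-dec all? (λ z → (z ~? w) →-dec (w Fin.≤? z))

  ∃-leader : ∀ {u} → u ~ u → ∃ λ w → Leader w × u ~ w
  ∃-leader {u} u~u with w , w~u , min ← least (_~? u) u~u =
    w , (~-trans w~u (~-sym w~u) , λ z z~w → min (~-trans z~w w~u)) , ~-sym w~u

  leader-unique : ∀ {w w′} → Leader w → Leader w′ → w ~ w′ → w ≡ w′
  leader-unique (_ , min) (_ , min′) w~w′ = Fin.≤-antisym (min _ (~-sym w~w′)) (min′ _ w~w′)

  count-leaders-of-class : ∀ u → count (λ w → leader? w ×-dec (u ~? w)) ≡ indicator (u ~? u)
  count-leaders-of-class u with u ~? u
  ... | no ¬u~u = count-none (λ w → leader? w ×-dec (u ~? w)) (λ _ (_ , u~w) → ¬u~u (~-trans u~w (~-sym u~w)))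
  ... | yes u~u with w , Lw , u~w ← ∃-leader u~u =
    count-unique (λ w → leader? w ×-dec (u ~? w)) (Lw , u~w)
                 (λ (Lw′ , u~w′) → leader-unique Lw′ Lw (~-trans (~-sym u~w′) u~w))

  uniform⇒*-count-leader : ∀ {c} → (∀ w → w ~ w → count (_~? w) ≡ c) →
                           c * count leader? ≡ count (λ u → u ~? u)
  uniform⇒*-count-leader {c} class-size = begin
    c * count leader?                                           ≡⟨ *-distribˡ-sum c (indicator ∘ leader?) ⟩
    ∑[ w < n ] (c * indicator (leader? w))                      ≡⟨ sum-cong-≗ (λ w → weigh (leader? w)) ⟩
    ∑[ w < n ] ∑[ u < n ] indicator (leader? w ×-dec (u ~? w))  ≡⟨ ∑-comm (λ w u → indicator (leader? w ×-dec (u ~? w))) ⟩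
    ∑[ u < n ] count (λ w → leader? w ×-dec (u ~? w))           ≡⟨ sum-cong-≗ count-leaders-of-class ⟩
    count (λ u → u ~? u)                                        ∎
    where
    open ≡-Reasoning
    weigh : ∀ {w} (Lw? : Dec (Leader w)) → c * indicator Lw? ≡ ∑[ u < n ] indicator (Lw? ×-dec (u ~? w))
    weigh {w} (yes (w~w , _)) = trans (*-identityʳ c) (sym (class-size w w~w))
    weigh {w} Lw?@(no ¬Lw)    = trans (*-zeroʳ c) (sym (count-none (λ u → Lw? ×-dec (u ~? w)) (λ _ (Lw , _) → ¬Lw Lw)))

  -- Junk value u when u is outside the domain of _~_.
  leader : Fin n → Fin n
  leader u with u ~? u
  ... | yes u~u = proj₁ (∃-leader u~u)
  ... | no _    = u

  leader-spec : ∀ {u} → u ~ u → Leader (leader u) × u ~ leader u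
  leader-spec {u} u~u with u ~? u
  ... | yes u~u′ = proj₂ (∃-leader u~u′)
  ... | no ¬u~u  = contradiction u~u ¬u~u

  leader-≡⇒~ : ∀ {u w} → u ~ u → w ~ w → leader u ≡ leader w → u ~ w
  leader-≡⇒~ {u} {w} u~u w~w ℓu≡ℓw =
    ~-trans (proj₂ (leader-spec u~u)) (subst (_~ w) (sym ℓu≡ℓw) (~-sym (proj₂ (leader-spec w~w))))

  inequivalent⇒length≤count-leader : ∀ {us} → AllPairs (λ u w → ¬ u ~ w) us → All (λ u → u ~ u) us →
                                     length us ≤ count leader?
  inequivalent⇒length≤count-leader {us} inequivalent domain =
    subst (_≤ count leader?) (length-map leader us)
          (length≤count leader? (distinct inequivalent domain) (All.map⁺ (All.map (proj₁ ∘ leader-spec) domain)))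
    where
    distinct : ∀ {us} → AllPairs (λ u w → ¬ u ~ w) us → All (λ u → u ~ u) us → Unique (List.map leader us)
    distinct []            []          = []
    distinct (u≁us ∷ ineq) (u~u ∷ dom) =
      All.map⁺ (All.zipWith (λ (u≁w , w~w) → u≁w ∘ leader-≡⇒~ u~u w~w) (u≁us , dom)) ∷ distinct ineq dom

module _ {n} (G : ThreeGraph n) where

  Edge : Fin n → Fin n → Fin n → Set
  Edge x y z = edge G x y z ≡ true

  edge? : ∀ x y z → Dec (Edge x y z)
  edge? x y z = edge G x y z Bool.≟ true

  Edge-swap₁₂ : ∀ {x y z} → Edge x y z → Edge y x z
  Edge-swap₁₂ {x} {y} {z} = trans (sym (sym₁₂ G x y z))

  Edge-swap₂₃ : ∀ {x y z} → Edge x y z → Edge x z y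
  Edge-swap₂₃ {x} {y} {z} = trans (sym (sym₂₃ G x y z))

  Edge-rotate : ∀ {x y z} → Edge x y z → Edge y z x
  Edge-rotate = Edge-swap₂₃ ∘ Edge-swap₁₂

  Edge⇒≢₁₂ : ∀ {x y z} → Edge x y z → x ≢ y
  Edge⇒≢₁₂ {x} {z = z} e refl with () ← trans (sym e) (loopless G x z)

  Edge⇒≢₁₃ : ∀ {x y z} → Edge x y z → x ≢ z
  Edge⇒≢₁₃ = Edge⇒≢₁₂ ∘ Edge-swap₂₃

  Edge⇒≢₂₃ : ∀ {x y z} → Edge x y z → y ≢ z
  Edge⇒≢₂₃ = Edge⇒≢₁₂ ∘ Edge-rotate

  codeg≡count : ∀ x y → codeg G x y ≡ count (edge? x y)
  codeg≡count x y = begin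
    listSum (List.map indicatorᵇ (List.allFin n))  ≡⟨ cong listSum (map-tabulate id indicatorᵇ) ⟩
    listSum (List.tabulate indicatorᵇ)             ≡⟨ listSum-tabulate indicatorᵇ ⟩
    ∑[ z < n ] indicatorᵇ z                        ≡⟨ sum-cong-≗ (λ z → if≡indicator (edge G x y z)) ⟩
    count (edge? x y)                              ∎
    where
    open ≡-Reasoning
    indicatorᵇ : Fin n → ℕ
    indicatorᵇ z = if edge G x y z then 1 else 0
    if≡indicator : ∀ b → (if b then 1 else 0) ≡ indicator (b Bool.≟ true)
    if≡indicator true  = refl
    if≡indicator false = refl

  codeg-comm : ∀ x y → codeg G x y ≡ codeg G y x
  codeg-comm x y = begin
    codeg G x y        ≡⟨ codeg≡count x y ⟩
    count (edge? x y)  ≡⟨ count-cong (edge? x y) (edge? y x) Edge-swap₁₂ Edge-swap₁₂ ⟩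
    count (edge? y x)  ≡⟨ codeg≡count y x ⟨
    codeg G y x        ∎
    where open ≡-Reasoning

  Edge⇒1≤codeg : ∀ {x y z} → Edge x y z → 1 ≤ codeg G x y
  Edge⇒1≤codeg {x} {y} e = subst (1 ≤_) (sym (codeg≡count x y)) (length≤count (edge? x y) ([] ∷ []) (e ∷ []))

  Edges⇒2≤codeg : ∀ {x y z₁ z₂} → Edge x y z₁ → Edge x y z₂ → z₁ ≢ z₂ → 2 ≤ codeg G x y
  Edges⇒2≤codeg {x} {y} e₁ e₂ z₁≢z₂ =
    subst (2 ≤_) (sym (codeg≡count x y)) (length≤count (edge? x y) ((z₁≢z₂ ∷ []) ∷ [] ∷ []) (e₁ ∷ e₂ ∷ []))

  codeg≤length : ∀ {x y} zs → (∀ {z} → Edge x y z → z ∈ zs) → codeg G x y ≤ length zs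
  codeg≤length {x} {y} zs link⊆zs = subst (_≤ length zs) (sym (codeg≡count x y)) (count≤length (edge? x y) link⊆zs)

  Covered : Fin n → Set
  Covered v = Σ (Fin 5 → Fin n) λ f → IsCopyOfT G f × Σ (Fin 5) λ i → f i ≡ v

  T-copy⇒Covered : ∀ {a b c d e} → Unique (a ∷ b ∷ c ∷ d ∷ e ∷ []) → Edge a b c → Edge a b d → Edge c d e →
                   ∀ i → Covered (List.lookup (a ∷ b ∷ c ∷ d ∷ e ∷ []) i)
  T-copy⇒Covered {a} {b} {c} {d} {e} distinct e₁ e₂ e₃ i =
    List.lookup (a ∷ b ∷ c ∷ d ∷ e ∷ []) , (lookup-injective distinct , e₁ , e₂ , e₃) , i , refl

-- A vertex in no copy of T

module Uncovered {n} (G : ThreeGraph n) (v : Fin n) (v-uncovered : ¬ Covered G v)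
                 (2≤codeg : ∀ {x y} → x ≢ y → 2 ≤ codeg G x y) where

  private
    E : Fin n → Fin n → Fin n → Set
    E = Edge G

  other-neighbour : ∀ {x y} → x ≢ y → ∀ a → ∃ λ z → E x y z × z ≢ a
  other-neighbour {x} {y} x≢y a
    with z , e , z∉[a] ← length<count⇒∃∉ (edge? G x y) (a ∷ []) (subst (1 <_) (codeg≡count G x y) (2≤codeg x≢y))
    = z , e , z∉[a] ∘ here

  no-T-from-v : ∀ {u a b w} → E v u a → E v u b → a ≢ b → E a b w → w ≡ v ⊎ w ≡ u
  no-T-from-v {u} {a} {b} {w} e₁ e₂ a≢b e₃ with w ≟ v | w ≟ u
  ... | yes w≡v | _       = inj₁ w≡v
  ... | no _    | yes w≡u = inj₂ w≡u
  ... | no w≢v  | no w≢u  = contradiction (T-copy⇒Covered G distinct e₁ e₂ e₃ 0F) v-uncovered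
    where
    distinct : Unique (v ∷ u ∷ a ∷ b ∷ w ∷ [])
    distinct = (Edge⇒≢₁₂ G e₁ ∷ Edge⇒≢₁₃ G e₁ ∷ Edge⇒≢₁₃ G e₂ ∷ w≢v ∘ sym ∷ [])
             ∷ (Edge⇒≢₂₃ G e₁ ∷ Edge⇒≢₂₃ G e₂ ∷ w≢u ∘ sym ∷ [])
             ∷ (a≢b ∷ Edge⇒≢₁₃ G e₃ ∷ []) ∷ (Edge⇒≢₂₃ G e₃ ∷ []) ∷ [] ∷ []

  link-closed : ∀ {u a b} → E v u a → E v u b → a ≢ b → E v a b
  link-closed {u} e₁ e₂ a≢b with w , e₃ , w≢u ← other-neighbour a≢b u with no-T-from-v e₁ e₂ a≢b e₃
  ... | inj₁ refl = Edge-rotate G (Edge-rotate G e₃)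
  ... | inj₂ w≡u  = contradiction w≡u w≢u

  link-unique : ∀ {u a b z} → E v u a → E v u b → a ≢ b → E v u z → z ≡ a ⊎ z ≡ b
  link-unique {u} {a} {b} {z} e₁ e₂ a≢b e₃ with z ≟ a | z ≟ b
  ... | yes z≡a | _       = inj₁ z≡a
  ... | no _    | yes z≡b = inj₂ z≡b
  ... | no z≢a  | no z≢b
    with w , e₄ , w≢v ← other-neighbour (z≢b ∘ sym) v
    with no-T-from-v e₂ e₃ (z≢b ∘ sym) e₄
       | no-T-from-v (link-closed e₁ e₂ a≢b) (link-closed e₁ e₃ (z≢a ∘ sym)) (z≢b ∘ sym) e₄
  ... | inj₁ w≡v | _        = contradiction w≡v w≢v
  ... | _        | inj₁ w≡v = contradiction w≡v w≢v
  ... | inj₂ w≡u | inj₂ w≡a = contradiction (trans (sym w≡u) w≡a) (Edge⇒≢₂₃ G e₁)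

  edge-on-link-pair : ∀ {p q w} → E v p q → E p q w → w ≡ v ⊎ E v p w
  edge-on-link-pair {p} {q} {w} e₁ e₂ with c , e₃ , c≢q ← other-neighbour (Edge⇒≢₁₂ G e₁) q
    with no-T-from-v (Edge-swap₂₃ G e₃) (Edge-swap₂₃ G (link-closed e₁ e₃ (c≢q ∘ sym))) (Edge⇒≢₂₃ G e₁) e₂
  ... | inj₁ w≡v  = inj₁ w≡v
  ... | inj₂ refl = inj₂ e₃

  link-pair : ∀ {u} → u ≢ v → ∃₂ λ a b → E v u a × E v u b × a ≢ b
  link-pair {u} u≢v with a , e₁ , _ ← other-neighbour (u≢v ∘ sym) u
    with b , e₂ , b≢a ← other-neighbour (u≢v ∘ sym) a = a , b , e₁ , e₂ , b≢a ∘ sym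

  codeg-v≡2 : ∀ {u} → u ≢ v → codeg G v u ≡ 2
  codeg-v≡2 u≢v with a , b , e₁ , e₂ , a≢b ← link-pair u≢v =
    ≤-antisym (codeg≤length G (a ∷ b ∷ []) (λ e → [ here , there ∘ here ]′ (link-unique e₁ e₂ a≢b e)))
              (2≤codeg (u≢v ∘ sym))

  -- u and w lie in the same triangle of the link graph of v; the domain is every vertex but v.
  _~_ : Fin n → Fin n → Set
  u ~ w = u ≢ v × (u ≡ w ⊎ E v u w)

  _~?_ : ∀ u w → Dec (u ~ w)
  u ~? w = ¬? (u ≟ v) ×-dec (u ≟ w ⊎-dec edge? G v u w)

  ~-sym : ∀ {u w} → u ~ w → w ~ u
  ~-sym (u≢v , inj₁ refl) = u≢v , inj₁ refl
  ~-sym (_   , inj₂ e)    = Edge⇒≢₁₃ G e ∘ sym , inj₂ (Edge-swap₂₃ G e)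

  ~-trans : ∀ {u w x} → u ~ w → w ~ x → u ~ x
  ~-trans (_ , inj₁ refl) w~x = w~x
  ~-trans u~w (_ , inj₁ refl) = u~w
  ~-trans {u} {w} {x} (u≢v , inj₂ e₁) (_ , inj₂ e₂) with u ≟ x
  ... | yes u≡x = u≢v , inj₁ u≡x
  ... | no u≢x  = u≢v , inj₂ (link-closed (Edge-swap₂₃ G e₁) e₂ u≢x)

  ≁-intro : ∀ {u w} → u ≢ w → ¬ E v u w → ¬ u ~ w
  ≁-intro u≢w _   (_ , inj₁ u≡w) = u≢w u≡w
  ≁-intro _   ¬uw (_ , inj₂ e)   = ¬uw e

  class-size : ∀ w → w ~ w → count (_~? w) ≡ 3
  class-size w (w≢v , _) = begin
    count (_~? w)                       ≡⟨ count-cong (_~? w) ((_≟ w) ∪? edge? G v w) to from ⟩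
    count ((_≟ w) ∪? edge? G v w)       ≡⟨ count-∪-disjoint (_≟ w) (edge? G v w) (λ { refl e → Edge⇒≢₂₃ G e refl }) ⟩
    count (_≟ w) + count (edge? G v w)  ≡⟨ cong₂ _+_ (count-unique (_≟ w) refl id) (sym (codeg≡count G v w)) ⟩
    1 + codeg G v w                     ≡⟨ cong suc (codeg-v≡2 w≢v) ⟩
    3                                   ∎
    where
    open ≡-Reasoning
    to : ∀ {u} → u ~ w → u ≡ w ⊎ E v w u
    to (_ , inj₁ u≡w) = inj₁ u≡w
    to (_ , inj₂ e)   = inj₂ (Edge-swap₂₃ G e)
    from : ∀ {u} → u ≡ w ⊎ E v w u → u ~ w
    from (inj₁ refl) = w≢v , inj₁ refl
    from (inj₂ e)    = Edge⇒≢₁₃ G e ∘ sym , inj₂ (Edge-swap₂₃ G e)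

  open PartialEquivalence ~-sym ~-trans _~?_ public

  3*count-leader≡n∸1 : 3 * count leader? ≡ n ∸ 1
  3*count-leader≡n∸1 = begin
    3 * count leader?     ≡⟨ uniform⇒*-count-leader class-size ⟩
    count (λ u → u ~? u)  ≡⟨ count-cong (λ u → u ~? u) (∁? (_≟ v)) proj₁ (λ u≢v → u≢v , inj₁ refl) ⟩
    count (∁? (_≟ v))     ≡⟨ count-≢ v ⟩
    n ∸ 1                 ∎
    where open ≡-Reasoning

  link-outside : ∀ {u d z} → u ≢ v → d ≢ v → ¬ E v u d → E u d z → z ≢ v × ¬ u ~ z × ¬ d ~ z
  link-outside {u} {d} {z} u≢v d≢v ¬vud e = z≢v , ≁-intro (Edge⇒≢₁₃ G e) ¬vuz , ≁-intro (Edge⇒≢₂₃ G e) ¬vdz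
    where
    z≢v : z ≢ v
    z≢v refl = ¬vud (Edge-rotate G (Edge-rotate G e))
    ¬vuz : ¬ E v u z
    ¬vuz e′ = [ d≢v , ¬vud ]′ (edge-on-link-pair e′ (Edge-swap₂₃ G e))
    ¬vdz : ¬ E v d z
    ¬vdz e′ = [ u≢v , ¬vud ∘ Edge-swap₂₃ G ]′ (edge-on-link-pair e′ (Edge-rotate G e))

  inequivalent-pair⇒4≤count-leader : ∀ {u d} → u ≢ v → d ≢ v → u ≢ d → ¬ E v u d → 4 ≤ count leader?
  inequivalent-pair⇒4≤count-leader {u} {d} u≢v d≢v u≢d ¬vud
    with x , eˣ , _      ← other-neighbour u≢d u
    with y , eʸ , y≢x    ← other-neighbour u≢d x
    with x≢v , u≁x , d≁x ← link-outside u≢v d≢v ¬vud eˣ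
    with y≢v , u≁y , d≁y ← link-outside u≢v d≢v ¬vud eʸ
    with edge? G v x y
  ... | yes exy = contradiction (T-copy⇒Covered G distinct eˣ eʸ (Edge-rotate G exy) 4F) v-uncovered
    where
    distinct : Unique (u ∷ d ∷ x ∷ y ∷ v ∷ [])
    distinct = (u≢d ∷ Edge⇒≢₁₃ G eˣ ∷ Edge⇒≢₁₃ G eʸ ∷ u≢v ∷ [])
             ∷ (Edge⇒≢₂₃ G eˣ ∷ Edge⇒≢₂₃ G eʸ ∷ d≢v ∷ []) ∷ (y≢x ∘ sym ∷ x≢v ∷ []) ∷ (y≢v ∷ []) ∷ [] ∷ []
  ... | no ¬exy = inequivalent⇒length≤count-leader
    ((≁-intro u≢d ¬vud ∷ u≁x ∷ u≁y ∷ []) ∷ (d≁x ∷ d≁y ∷ []) ∷ (≁-intro (y≢x ∘ sym) ¬exy ∷ []) ∷ [] ∷ [])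
    ((u≢v , inj₁ refl) ∷ (d≢v , inj₁ refl) ∷ (x≢v , inj₁ refl) ∷ (y≢v , inj₁ refl) ∷ [])

  4≤count-leader : 5 ≤ n → 4 ≤ count leader?
  4≤count-leader 5≤n
    with u , u∉[v]       ← length<n⇒∃∉ (v ∷ []) (≤-trans (s≤s (s≤s z≤n)) 5≤n)
    with a , b , e₁ , e₂ , a≢b ← link-pair (u∉[v] ∘ here)
    with d , d∉vuab      ← length<n⇒∃∉ (v ∷ u ∷ a ∷ b ∷ []) 5≤n
    = inequivalent-pair⇒4≤count-leader (u∉[v] ∘ here) (d∉vuab ∘ here) (d∉vuab ∘ there ∘ here ∘ sym)
        (λ e → [ d∉vuab ∘ there ∘ there ∘ here , d∉vuab ∘ there ∘ there ∘ there ∘ here ]′ (link-unique e₁ e₂ a≢b e))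

-- Upper bound

¬¬-shift : ∀ {n p} {P : Pred (Fin n) p} → (∀ i → ¬ ¬ P i) → ¬ ¬ (∀ i → P i)
¬¬-shift {zero}  _   ¬∀P = ¬∀P λ ()
¬¬-shift {suc n} ¬¬P ¬∀P = ¬¬P 0F λ P0 → ¬¬-shift (¬¬P ∘ sucF) λ ∀P → ¬∀P λ { 0F → P0 ; (sucF i) → ∀P i }

¬∀-elim : ∀ {n p q} {P : Pred (Fin n) p} {Q : Set q} → Dec Q → ¬ (∀ i → P i) → (∀ i → ¬ P i → Q) → Q
¬∀-elim (yes q) _   _    = q
¬∀-elim (no ¬q) ¬∀P ¬P⇒Q = ⊥-elim (¬¬-shift (λ i ¬Pi → ¬q (¬P⇒Q i ¬Pi)) ¬∀P)

1≤c2Value : ∀ n → 1 ≤ c2Value n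
1≤c2Value n with n ≤ᵇ 10
... | true  = ≤-refl
... | false with (n ∸ 1) % 3 ≡ᵇ 0
...   | true  = s≤s z≤n
...   | false = ≤-refl

c2Value≡2 : ∀ {n} → 11 ≤ n → (n ∸ 1) % 3 ≡ 0 → c2Value n ≡ 2
c2Value≡2 {n} 11≤n n∸1%3≡0 with n ≤ᵇ 10 in n≤ᵇ10
... | true  = contradiction (≤ᵇ⇒≤ n 10 (subst T (sym n≤ᵇ10) tt)) (<⇒≱ 11≤n)
... | false rewrite n∸1%3≡0 = refl

c2Value-cases : ∀ n → c2Value n ≡ 1 ⊎ (11 ≤ n × (n ∸ 1) % 3 ≡ 0)
c2Value-cases n with n ≤ᵇ 10 in n≤ᵇ10
... | true  = inj₁ refl
... | false with (n ∸ 1) % 3 ≡ᵇ 0 in n∸1%3≡ᵇ0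
...   | false = inj₁ refl
...   | true  = inj₂ (≰⇒> (λ n≤10 → subst T n≤ᵇ10 (≤⇒≤ᵇ n≤10)) , ≡ᵇ⇒≡ _ 0 (subst T (sym n∸1%3≡ᵇ0) tt))

upper-bound : ∀ {n} → 5 ≤ n → (G : ThreeGraph n) (d : ℕ) → ¬ HasTCovering G → MinCodeg G d → d ≤ c2Value n
upper-bound {n} 5≤n G d ¬covering (d≤codeg , _) with d ≤? 1
... | yes d≤1 = ≤-trans d≤1 (1≤c2Value n)
... | no d≰1  = ¬∀-elim (d ≤? c2Value n) ¬covering at-uncovered
  where
  at-uncovered : ∀ v → ¬ Covered G v → d ≤ c2Value n
  at-uncovered v v-uncovered with u , u∉[v] ← length<n⇒∃∉ (v ∷ []) (≤-trans (s≤s (s≤s z≤n)) 5≤n) = begin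
    d            ≤⟨ d≤codeg v u (u∉[v] ∘ here ∘ sym) ⟩
    codeg G v u  ≡⟨ codeg-v≡2 (u∉[v] ∘ here) ⟩
    2            ≡⟨ c2Value≡2 11≤n n∸1%3≡0 ⟨
    c2Value n    ∎
    where
    open Uncovered G v v-uncovered (λ {x} {y} x≢y → ≤-trans (≰⇒> d≰1) (d≤codeg x y x≢y))
    open ≤-Reasoning
    12≤n∸1 : 12 ≤ n ∸ 1
    12≤n∸1 = subst (12 ≤_) 3*count-leader≡n∸1 (*-monoʳ-≤ 3 (4≤count-leader 5≤n))
    11≤n : 11 ≤ n
    11≤n = ≤-trans (n≤1+n 11) (≤-trans 12≤n∸1 (m∸n≤m n 1))
    n∸1%3≡0 : (n ∸ 1) % 3 ≡ 0
    n∸1%3≡0 = subst (λ m → m % 3 ≡ 0) (trans (*-comm (count leader?) 3) 3*count-leader≡n∸1) (m*n%n≡0 (count leader?) 3)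

dec-true⁻ : ∀ {a} {A : Set a} (a? : Dec A) → does a? ≡ true → A
dec-true⁻ (yes a) _ = a

Distinct : ∀ {n} → Fin n → Fin n → Fin n → Set
Distinct x y z = x ≢ y × x ≢ z × y ≢ z

module _ {n} {Q : Fin n → Fin n → Fin n → Set} (Q? : ∀ x y z → Dec (Q x y z))
         (Q-swap₁₂ : ∀ {x y z} → Q x y z → Q y x z) (Q-swap₂₃ : ∀ {x y z} → Q x y z → Q x z y) where

  private
    Edge? : ∀ x y z → Dec (Distinct x y z × Q x y z)
    Edge? x y z = (¬? (x ≟ y) ×-dec ¬? (x ≟ z) ×-dec ¬? (y ≟ z)) ×-dec Q? x y z

    swap₁₂ : ∀ {x y z} → Distinct x y z × Q x y z → Distinct y x z × Q y x z
    swap₁₂ ((x≢y , x≢z , y≢z) , q) = (x≢y ∘ sym , y≢z , x≢z) , Q-swap₁₂ q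

    swap₂₃ : ∀ {x y z} → Distinct x y z × Q x y z → Distinct x z y × Q x z y
    swap₂₃ ((x≢y , x≢z , y≢z) , q) = (x≢z , x≢y , y≢z ∘ sym) , Q-swap₂₃ q

  -- Opaque, so that the vertices x y z of Edge fromPredicate x y z stay visible to unification.
  opaque
    fromPredicate : ThreeGraph n
    fromPredicate = record
      { edge     = λ x y z → does (Edge? x y z)
      ; sym₁₂    = λ x y z → does-⇔ (mk⇔ swap₁₂ swap₁₂) (Edge? x y z) (Edge? y x z)
      ; sym₂₃    = λ x y z → does-⇔ (mk⇔ swap₂₃ swap₂₃) (Edge? x y z) (Edge? x z y)
      ; loopless = λ x z → dec-false (Edge? x x z) (λ ((x≢x , _) , _) → x≢x refl)
      }

    fromPredicate-Edge⁺ : ∀ {x y z} → Distinct x y z → Q x y z → Edge fromPredicate x y z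
    fromPredicate-Edge⁺ {x} {y} {z} d q = dec-true (Edge? x y z) (d , q)

    fromPredicate-Edge⁻ : ∀ {x y z} → Edge fromPredicate x y z → Distinct x y z × Q x y z
    fromPredicate-Edge⁻ {x} {y} {z} = dec-true⁻ (Edge? x y z)

-- The star

module StarGraph (m : ℕ) where

  ThroughCentre : Fin (suc m) → Fin (suc m) → Fin (suc m) → Set
  ThroughCentre x y z = x ≡ 0F ⊎ y ≡ 0F ⊎ z ≡ 0F

  throughCentre? : ∀ x y z → Dec (ThroughCentre x y z)
  throughCentre? x y z = x ≟ 0F ⊎-dec y ≟ 0F ⊎-dec z ≟ 0F

  ThroughCentre-swap₁₂ : ∀ {x y z} → ThroughCentre x y z → ThroughCentre y x z
  ThroughCentre-swap₁₂ = [ inj₂ ∘ inj₁ , [ inj₁ , inj₂ ∘ inj₂ ]′ ]′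

  ThroughCentre-swap₂₃ : ∀ {x y z} → ThroughCentre x y z → ThroughCentre x z y
  ThroughCentre-swap₂₃ = [ inj₁ , [ inj₂ ∘ inj₂ , inj₂ ∘ inj₁ ]′ ]′

  star : ThreeGraph (suc m)
  star = fromPredicate throughCentre? ThroughCentre-swap₁₂ ThroughCentre-swap₂₃

  star-Edge⁺ : ∀ {x y z} → Distinct x y z → ThroughCentre x y z → Edge star x y z
  star-Edge⁺ = fromPredicate-Edge⁺ throughCentre? ThroughCentre-swap₁₂ ThroughCentre-swap₂₃

  star-Edge⁻ : ∀ {x y z} → Edge star x y z → ThroughCentre x y z
  star-Edge⁻ = proj₂ ∘ fromPredicate-Edge⁻ throughCentre? ThroughCentre-swap₁₂ ThroughCentre-swap₂₃

  edges-meet-at-centre : ∀ {x y z u w} → Edge star x y z → Edge star z u w →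
                         x ≢ u → x ≢ w → y ≢ u → y ≢ w → z ≡ 0F
  edges-meet-at-centre e₁ e₂ x≢u x≢w y≢u y≢w with star-Edge⁻ e₁ | star-Edge⁻ e₂
  ... | inj₂ (inj₂ z≡0) | _               = z≡0
  ... | _               | inj₁ z≡0        = z≡0
  ... | inj₁ x≡0        | inj₂ (inj₁ u≡0) = contradiction (trans x≡0 (sym u≡0)) x≢u
  ... | inj₁ x≡0        | inj₂ (inj₂ w≡0) = contradiction (trans x≡0 (sym w≡0)) x≢w
  ... | inj₂ (inj₁ y≡0) | inj₂ (inj₁ u≡0) = contradiction (trans y≡0 (sym u≡0)) y≢u
  ... | inj₂ (inj₁ y≡0) | inj₂ (inj₂ w≡0) = contradiction (trans y≡0 (sym w≡0)) y≢w

  star-no-copy : ∀ f → ¬ IsCopyOfT star f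
  star-no-copy f (f-injective , e₁ , e₂ , e₃) = contradiction (f-injective (trans f₃≡0 (sym f₄≡0))) λ ()
    where
    ≢⇒f≢ : ∀ {i j} → i ≢ j → f i ≢ f j
    ≢⇒f≢ i≢j = i≢j ∘ f-injective
    f₃≡0 : f v₃ ≡ 0F
    f₃≡0 = edges-meet-at-centre e₁ e₃ (≢⇒f≢ λ ()) (≢⇒f≢ λ ()) (≢⇒f≢ λ ()) (≢⇒f≢ λ ())
    f₄≡0 : f v₄ ≡ 0F
    f₄≡0 = edges-meet-at-centre e₂ (Edge-swap₁₂ star e₃) (≢⇒f≢ λ ()) (≢⇒f≢ λ ()) (≢⇒f≢ λ ()) (≢⇒f≢ λ ())

  star-no-covering : ¬ HasTCovering star
  star-no-covering covering = star-no-copy _ (proj₁ (proj₂ (covering 0F)))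

  module _ (2≤m : 2 ≤ m) where

    star-1≤codeg : ∀ x y → x ≢ y → 1 ≤ codeg star x y
    star-1≤codeg x y x≢y = cases (x ≟ 0F) (y ≟ 0F)
      where
      via-third-vertex : (∀ z → ThroughCentre x y z) → 1 ≤ codeg star x y
      via-third-vertex through with z , z∉xy ← length<n⇒∃∉ (x ∷ y ∷ []) (s≤s 2≤m) =
        Edge⇒1≤codeg star (star-Edge⁺ (x≢y , z∉xy ∘ here ∘ sym , z∉xy ∘ there ∘ here ∘ sym) (through z))
      cases : Dec (x ≡ 0F) → Dec (y ≡ 0F) → 1 ≤ codeg star x y
      cases (no x≢0)  (no y≢0)  = Edge⇒1≤codeg star (star-Edge⁺ (x≢y , x≢0 , y≢0) (inj₂ (inj₂ refl)))
      cases (yes x≡0) _         = via-third-vertex (λ _ → inj₁ x≡0)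
      cases (no _)    (yes y≡0) = via-third-vertex (λ _ → inj₂ (inj₁ y≡0))

    star-min-codeg : MinCodeg star 1
    star-min-codeg
      with y , y∉[0] ← length<n⇒∃∉ (0F ∷ []) (≤-trans (n≤1+n 2) (s≤s 2≤m))
      with z , z∉0y  ← length<n⇒∃∉ (0F ∷ y ∷ []) (s≤s 2≤m) =
      star-1≤codeg , y , z , z≢y ∘ sym , ≤-antisym (codeg≤length star (0F ∷ []) link⊆[0]) (star-1≤codeg y z (z≢y ∘ sym))
      where
      z≢y : z ≢ y
      z≢y = z∉0y ∘ there ∘ here
      link⊆[0] : ∀ {w} → Edge star y z w → w ∈ 0F ∷ []
      link⊆[0] e = here ([ ⊥-elim ∘ y∉[0] ∘ here , [ ⊥-elim ∘ z∉0y ∘ here , id ]′ ]′ (star-Edge⁻ e))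

-- The construction for n = 3k + 1

-- Opaque for the same reason as fromPredicate.
opaque
  ZeroSum : Fin 3 → Fin 3 → Fin 3 → Set
  ZeroSum a b c = (toℕ a + toℕ b + toℕ c) % 3 ≡ 0

  zeroSum? : ∀ a b c → Dec (ZeroSum a b c)
  zeroSum? a b c = (toℕ a + toℕ b + toℕ c) % 3 ℕ.≟ 0

  ZeroSum-swap₁₂ : ∀ {a b c} → ZeroSum a b c → ZeroSum b a c
  ZeroSum-swap₁₂ {a} {b} {c} = subst (λ s → (s + toℕ c) % 3 ≡ 0) (+-comm (toℕ a) (toℕ b))

  ZeroSum-swap₂₃ : ∀ {a b c} → ZeroSum a b c → ZeroSum a c b
  ZeroSum-swap₂₃ {a} {b} {c} = subst (λ s → s % 3 ≡ 0) (begin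
    toℕ a + toℕ b + toℕ c    ≡⟨ +-assoc (toℕ a) _ _ ⟩
    toℕ a + (toℕ b + toℕ c)  ≡⟨ cong (toℕ a +_) (+-comm (toℕ b) _) ⟩
    toℕ a + (toℕ c + toℕ b)  ≡⟨ +-assoc (toℕ a) _ _ ⟨
    toℕ a + toℕ c + toℕ b    ∎)
    where open ≡-Reasoning

  ZeroSum-unique : ∀ {a b c c′} → ZeroSum a b c → ZeroSum a b c′ → c ≡ c′
  ZeroSum-unique {a} {b} {c} {c′} = from-yes
    (all? λ a → all? λ b → all? λ c → all? λ c′ → zeroSum? a b c →-dec (zeroSum? a b c′ →-dec c ≟ c′)) a b c c′

  third-colour : ∀ a b → ∃ λ c → ZeroSum a b c
  third-colour = from-yes (all? λ a → all? λ b → any? (zeroSum? a b))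

module Construction (k : ℕ) (4≤k : 4 ≤ k) where

  V : Set
  V = Fin (suc (k * 3))

  apex : V
  apex = 0F

  vertex : Fin k → Fin 3 → V
  vertex t c = sucF (combine t c)

  blockOf : Fin (k * 3) → Fin k
  blockOf = quotient 3

  colourOf : Fin (k * 3) → Fin 3
  colourOf = remainder {k} 3

  blockOf-combine : ∀ t c → blockOf (combine t c) ≡ t
  blockOf-combine t c = cong proj₁ (remQuot-combine t c)

  colourOf-combine : ∀ t c → colourOf (combine t c) ≡ c
  colourOf-combine t c = cong proj₂ (remQuot-combine {k} t c)

  -- 0F is a junk colour for the apex: colours are only compared on triples avoiding it.
  colour : V → Fin 3
  colour 0F       = 0F
  colour (sucF a) = colourOf a

  Block : V → V → Set
  Block 0F       _        = ⊥
  Block (sucF _) 0F       = ⊥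
  Block (sucF a) (sucF b) = blockOf a ≡ blockOf b

  block? : ∀ x y → Dec (Block x y)
  block? 0F       _        = no id
  block? (sucF _) 0F       = no id
  block? (sucF a) (sucF b) = blockOf a ≟ blockOf b

  Block-refl : ∀ {x} → x ≢ apex → Block x x
  Block-refl {0F}     x≢apex = x≢apex refl
  Block-refl {sucF _} _      = refl

  Block-sym : ∀ {x y} → Block x y → Block y x
  Block-sym {sucF _} {sucF _} = sym

  Block-trans : ∀ {x y z} → Block x y → Block y z → Block x z
  Block-trans {sucF _} {sucF _} {sucF _} = trans

  Block-colour⇒≡ : ∀ {x y} → Block x y → colour x ≡ colour y → x ≡ y
  Block-colour⇒≡ {sucF a} {sucF b} same-block same-colour = cong sucF (begin
    a                                 ≡⟨ combine-remQuot {k} 3 a ⟨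
    combine (blockOf a) (colourOf a)  ≡⟨ cong₂ combine same-block same-colour ⟩
    combine (blockOf b) (colourOf b)  ≡⟨ combine-remQuot {k} 3 b ⟩
    b                                 ∎)
    where open ≡-Reasoning

  Close : V → V → Set
  Close x y = x ≡ apex ⊎ y ≡ apex ⊎ Block x y

  close? : ∀ x y → Dec (Close x y)
  close? x y = x ≟ apex ⊎-dec y ≟ apex ⊎-dec block? x y

  Close-sym : ∀ {x y} → Close x y → Close y x
  Close-sym = [ inj₂ ∘ inj₁ , [ inj₁ , inj₂ ∘ inj₂ ∘ Block-sym ]′ ]′

  Close⇒Block : ∀ {x y} → x ≢ apex → y ≢ apex → Close x y → Block x y
  Close⇒Block x≢apex y≢apex = [ ⊥-elim ∘ x≢apex , [ ⊥-elim ∘ y≢apex , id ]′ ]′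

  Triple : V → V → V → Set
  Triple x y z = (Close x y × Close x z × Close y z)
               ⊎ (¬ Close x y × ¬ Close x z × ¬ Close y z × ZeroSum (colour x) (colour y) (colour z))

  triple? : ∀ x y z → Dec (Triple x y z)
  triple? x y z =
    (close? x y ×-dec close? x z ×-dec close? y z)
    ⊎-dec (¬? (close? x y) ×-dec ¬? (close? x z) ×-dec ¬? (close? y z) ×-dec zeroSum? (colour x) (colour y) (colour z))

  Triple-swap₁₂ : ∀ {x y z} → Triple x y z → Triple y x z
  Triple-swap₁₂ (inj₁ (cxy , cxz , cyz))        = inj₁ (Close-sym cxy , cyz , cxz)
  Triple-swap₁₂ (inj₂ (¬cxy , ¬cxz , ¬cyz , s)) = inj₂ (¬cxy ∘ Close-sym , ¬cyz , ¬cxz , ZeroSum-swap₁₂ s)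

  Triple-swap₂₃ : ∀ {x y z} → Triple x y z → Triple x z y
  Triple-swap₂₃ (inj₁ (cxy , cxz , cyz))        = inj₁ (cxz , cxy , Close-sym cyz)
  Triple-swap₂₃ (inj₂ (¬cxy , ¬cxz , ¬cyz , s)) = inj₂ (¬cxz , ¬cxy , ¬cyz ∘ Close-sym , ZeroSum-swap₂₃ s)

  Triple-rotate : ∀ {x y z} → Triple x y z → Triple z x y
  Triple-rotate = Triple-swap₁₂ ∘ Triple-swap₂₃

  extremal : ThreeGraph (suc (k * 3))
  extremal = fromPredicate triple? Triple-swap₁₂ Triple-swap₂₃

  extremal-Edge⁺ : ∀ {x y z} → Distinct x y z → Triple x y z → Edge extremal x y z
  extremal-Edge⁺ = fromPredicate-Edge⁺ triple? Triple-swap₁₂ Triple-swap₂₃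

  extremal-Edge⁻ : ∀ {x y z} → Edge extremal x y z → Triple x y z
  extremal-Edge⁻ = proj₂ ∘ fromPredicate-Edge⁻ triple? Triple-swap₁₂ Triple-swap₂₃

  Block-vertex : ∀ {a t} c → blockOf a ≡ t → Block (sucF a) (vertex t c)
  Block-vertex {t = t} c a∈t = trans a∈t (sym (blockOf-combine t c))

  vertex-injective : ∀ {t c t′ c′} → vertex t c ≡ vertex t′ c′ → t ≡ t′ × c ≡ c′
  vertex-injective = combine-injective _ _ _ _ ∘ suc-injective

  ≢vertex-colour : ∀ {a t c} → colourOf a ≢ c → sucF a ≢ vertex t c
  ≢vertex-colour {t = t} {c} a≢c a≡v = a≢c (trans (cong colour a≡v) (colourOf-combine t c))

  ≢vertex-block : ∀ {a t c} → blockOf a ≢ t → sucF a ≢ vertex t c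
  ≢vertex-block {t = t} {c} a∉t a≡v = a∉t (trans (cong blockOf (suc-injective a≡v)) (blockOf-combine t c))

  in-block : ∀ {a z c} → Block (sucF a) z → colour z ≡ c → z ≡ vertex (blockOf a) c
  in-block {a} {z} {c} a∼z z∈c =
    Block-colour⇒≡ (Block-trans (Block-sym a∼z) (Block-vertex c refl))
                   (trans z∈c (sym (colourOf-combine (blockOf a) c)))

  Triple-apex : ∀ {x y z} → x ≡ apex → Triple x y z → Close y z
  Triple-apex _      (inj₁ (_ , _ , cyz)) = cyz
  Triple-apex x≡apex (inj₂ (¬cxy , _))    = contradiction (inj₁ x≡apex) ¬cxy

  Triple-close : ∀ {x y z} → Triple x y z → Close x y → Close x z
  Triple-close (inj₁ (_ , cxz , _)) _   = cxz
  Triple-close (inj₂ (¬cxy , _))    cxy = contradiction cxy ¬cxy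

  Triple-far : ∀ {x y z} → Triple x y z → ¬ Close x y → ZeroSum (colour x) (colour y) (colour z)
  Triple-far (inj₁ (cxy , _))       ¬cxy = contradiction cxy ¬cxy
  Triple-far (inj₂ (_ , _ , _ , s)) _    = s

  ¬Close : ∀ {a b} → blockOf a ≢ blockOf b → ¬ Close (sucF a) (sucF b)
  ¬Close a≁b = [ (λ ()) , [ (λ ()) , a≁b ]′ ]′

  apex-link : ∀ a → ∃₂ λ z₁ z₂ → Edge extremal apex (sucF a) z₁ × Edge extremal apex (sucF a) z₂ × z₁ ≢ z₂ ×
                                  (∀ {z} → Edge extremal apex (sucF a) z → z ∈ z₁ ∷ z₂ ∷ [])
  apex-link a
    with c₁ , c₁∉[c] ← length<n⇒∃∉ (colourOf a ∷ []) (s≤s (s≤s z≤n))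
    with c₂ , c₂∉[c,c₁] ← length<n⇒∃∉ (colourOf a ∷ c₁ ∷ []) ≤-refl =
    vertex t c₁ , vertex t c₂ , edge-to (c₁∉[c] ∘ here ∘ sym) , edge-to (c₂∉[c,c₁] ∘ here ∘ sym) ,
    c₂∉[c,c₁] ∘ there ∘ here ∘ sym ∘ proj₂ ∘ vertex-injective , link⊆
    where
    t : Fin k
    t = blockOf a
    colours : Unique (colourOf a ∷ c₁ ∷ c₂ ∷ [])
    colours = (c₁∉[c] ∘ here ∘ sym ∷ c₂∉[c,c₁] ∘ here ∘ sym ∷ []) ∷ (c₂∉[c,c₁] ∘ there ∘ here ∘ sym ∷ []) ∷ [] ∷ []
    link⊆ : ∀ {z} → Edge extremal apex (sucF a) z → z ∈ vertex t c₁ ∷ vertex t c₂ ∷ []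
    link⊆ {z} e with (_ , apex≢z , a≢z) , triple ← fromPredicate-Edge⁻ triple? Triple-swap₁₂ Triple-swap₂₃ e
      with a∼z ← Close⇒Block (λ ()) (apex≢z ∘ sym) (Triple-apex refl triple)
      with unique-length≡n⇒∈ colours refl (colour z)
    ... | here z∈c                   = contradiction (sym (Block-colour⇒≡ (Block-sym a∼z) z∈c)) a≢z
    ... | there (here z∈c₁)          = here (in-block a∼z z∈c₁)
    ... | there (there (here z∈c₂)) = there (here (in-block a∼z z∈c₂))
    edge-to : ∀ {c} → colourOf a ≢ c → Edge extremal apex (sucF a) (vertex t c)
    edge-to {c} a≢c = extremal-Edge⁺ ((λ ()) , (λ ()) , ≢vertex-colour a≢c)
                                     (inj₁ (inj₁ refl , inj₁ refl , inj₂ (inj₂ (Block-vertex c refl))))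

  same-block-codeg : ∀ {a b} → a ≢ b → blockOf a ≡ blockOf b → 2 ≤ codeg extremal (sucF a) (sucF b)
  same-block-codeg {a} {b} a≢b a∼b with c , c∉ab ← length<n⇒∃∉ (colourOf a ∷ colourOf b ∷ []) ≤-refl =
    Edges⇒2≤codeg extremal
      (extremal-Edge⁺ (a≢b ∘ suc-injective , (λ ()) , (λ ()))
                      (inj₁ (inj₂ (inj₂ a∼b) , inj₂ (inj₁ refl) , inj₂ (inj₁ refl))))
      (extremal-Edge⁺ (a≢b ∘ suc-injective , ≢vertex-colour (c∉ab ∘ here ∘ sym) ,
                       ≢vertex-colour (c∉ab ∘ there ∘ here ∘ sym))
                      (inj₁ (inj₂ (inj₂ a∼b) , inj₂ (inj₂ (Block-vertex c refl)) ,
                             inj₂ (inj₂ (Block-vertex c (sym a∼b))))))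
      (λ ())

  cross-codeg : ∀ {a b} → blockOf a ≢ blockOf b → 2 ≤ codeg extremal (sucF a) (sucF b)
  cross-codeg {a} {b} a≁b
    with c , zero-sum ← third-colour (colourOf a) (colourOf b)
    with t₁ , t₁∉ab  ← length<n⇒∃∉ (blockOf a ∷ blockOf b ∷ []) (≤-trans (n≤1+n 3) 4≤k)
    with t₂ , t₂∉t₁ab ← length<n⇒∃∉ (t₁ ∷ blockOf a ∷ blockOf b ∷ []) 4≤k =
    Edges⇒2≤codeg extremal (edge-to (t₁∉ab ∘ here ∘ sym) (t₁∉ab ∘ there ∘ here ∘ sym))
                           (edge-to (t₂∉t₁ab ∘ there ∘ here ∘ sym) (t₂∉t₁ab ∘ there ∘ there ∘ here ∘ sym))
                           (t₂∉t₁ab ∘ here ∘ sym ∘ proj₁ ∘ vertex-injective)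
    where
    edge-to : ∀ {t} → blockOf a ≢ t → blockOf b ≢ t → Edge extremal (sucF a) (sucF b) (vertex t c)
    edge-to {t} a∉t b∉t = extremal-Edge⁺
      (a≁b ∘ cong blockOf ∘ suc-injective , ≢vertex-block a∉t , ≢vertex-block b∉t)
      (inj₂ (¬Close a≁b , ¬Close (a∉t ∘ (λ a∼v → trans a∼v (blockOf-combine t c))) ,
             ¬Close (b∉t ∘ (λ b∼v → trans b∼v (blockOf-combine t c))) ,
             subst (ZeroSum _ _) (sym (colourOf-combine t c)) zero-sum))

  apex-codeg : ∀ a → codeg extremal apex (sucF a) ≡ 2
  apex-codeg a =
    let z₁ , z₂ , e₁ , e₂ , z₁≢z₂ , link⊆ = apex-link a
    in ≤-antisym (codeg≤length extremal (z₁ ∷ z₂ ∷ []) link⊆) (Edges⇒2≤codeg extremal e₁ e₂ z₁≢z₂)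

  extremal-2≤codeg : ∀ x y → x ≢ y → 2 ≤ codeg extremal x y
  extremal-2≤codeg 0F       0F       x≢y = contradiction refl x≢y
  extremal-2≤codeg 0F       (sucF b) _   = ≤-reflexive (sym (apex-codeg b))
  extremal-2≤codeg (sucF a) 0F       _   = ≤-reflexive (sym (trans (codeg-comm extremal (sucF a) apex) (apex-codeg a)))
  extremal-2≤codeg (sucF a) (sucF b) a≢b with blockOf a ≟ blockOf b
  ... | yes a∼b = same-block-codeg (a≢b ∘ cong sucF) a∼b
  ... | no a≁b  = cross-codeg a≁b

  extremal-min-codeg : MinCodeg extremal 2
  extremal-min-codeg = extremal-2≤codeg , apex , sucF a₀ , (λ ()) , apex-codeg a₀
    where
    a₀ : Fin (k * 3)
    a₀ = combine (Fin.fromℕ< (≤-trans (s≤s z≤n) 4≤k)) 0F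

  block-bound : ∀ {m x} (g : Fin m → V) → Injective _≡_ _≡_ g → (∀ j → Block x (g j)) → m ≤ 3
  block-bound g g-injective in-block = injective⇒≤ {f = colour ∘ g} λ {i} {j} same-colour →
    g-injective (Block-colour⇒≡ (Block-trans (Block-sym (in-block i)) (in-block j)) same-colour)

  module CopyOfT {f : Fin 5 → V} (copy : IsCopyOfT extremal f) where

    private
      T₁ : Triple (f v₁) (f v₂) (f v₃)
      T₁ = extremal-Edge⁻ (proj₁ (proj₂ copy))
      T₂ : Triple (f v₁) (f v₂) (f v₄)
      T₂ = extremal-Edge⁻ (proj₁ (proj₂ (proj₂ copy)))
      T₃ : Triple (f v₃) (f v₄) (f v₅)
      T₃ = extremal-Edge⁻ (proj₂ (proj₂ (proj₂ copy)))

      apart : ∀ {i j} → i ≢ j → f j ≡ apex → f i ≢ apex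
      apart i≢j fj≡apex fi≡apex = i≢j (proj₁ copy (trans fi≡apex (sym fj≡apex)))

      block : ∀ {a i j} → f a ≡ apex → a ≢ i → a ≢ j → Close (f i) (f j) → Block (f i) (f j)
      block fa≡apex a≢i a≢j = Close⇒Block (apart (a≢i ∘ sym) fa≡apex) (apart (a≢j ∘ sym) fa≡apex)

    InOneBlock : Fin 5 → Set
    InOneBlock i = ∃ λ x → ∀ j → Block x (f (punchIn i j))

    apex-at-v₁ : f v₁ ≡ apex → InOneBlock v₁
    apex-at-v₁ f₁≡apex = f v₂ ,
      λ { 0F → Block-refl (apart (λ ()) f₁≡apex) ; 1F → b₂₃ ; 2F → b₂₄ ; 3F → Block-trans b₂₃ b₃₅ }
      where
      b₂₃ : Block (f v₂) (f v₃)
      b₂₃ = block f₁≡apex (λ ()) (λ ()) (Triple-apex f₁≡apex T₁)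
      b₂₄ : Block (f v₂) (f v₄)
      b₂₄ = block f₁≡apex (λ ()) (λ ()) (Triple-apex f₁≡apex T₂)
      b₃₅ : Block (f v₃) (f v₅)
      b₃₅ = block f₁≡apex (λ ()) (λ ()) (Triple-close T₃ (inj₂ (inj₂ (Block-trans (Block-sym b₂₃) b₂₄))))

    apex-at-v₂ : f v₂ ≡ apex → InOneBlock v₂
    apex-at-v₂ f₂≡apex = f v₁ ,
      λ { 0F → Block-refl (apart (λ ()) f₂≡apex) ; 1F → b₁₃ ; 2F → b₁₄ ; 3F → Block-trans b₁₃ b₃₅ }
      where
      b₁₃ : Block (f v₁) (f v₃)
      b₁₃ = block f₂≡apex (λ ()) (λ ()) (Triple-apex f₂≡apex (Triple-swap₁₂ T₁))
      b₁₄ : Block (f v₁) (f v₄)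
      b₁₄ = block f₂≡apex (λ ()) (λ ()) (Triple-apex f₂≡apex (Triple-swap₁₂ T₂))
      b₃₅ : Block (f v₃) (f v₅)
      b₃₅ = block f₂≡apex (λ ()) (λ ()) (Triple-close T₃ (inj₂ (inj₂ (Block-trans (Block-sym b₁₃) b₁₄))))

    apex-at-v₃ : f v₃ ≡ apex → InOneBlock v₃
    apex-at-v₃ f₃≡apex = f v₁ ,
      λ { 0F → Block-refl (apart (λ ()) f₃≡apex) ; 1F → b₁₂ ; 2F → b₁₄ ; 3F → Block-trans b₁₄ b₄₅ }
      where
      b₁₂ : Block (f v₁) (f v₂)
      b₁₂ = block f₃≡apex (λ ()) (λ ()) (Triple-apex f₃≡apex (Triple-rotate T₁))
      b₁₄ : Block (f v₁) (f v₄)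
      b₁₄ = block f₃≡apex (λ ()) (λ ()) (Triple-close T₂ (inj₂ (inj₂ b₁₂)))
      b₄₅ : Block (f v₄) (f v₅)
      b₄₅ = block f₃≡apex (λ ()) (λ ()) (Triple-apex f₃≡apex T₃)

    apex-at-v₄ : f v₄ ≡ apex → InOneBlock v₄
    apex-at-v₄ f₄≡apex = f v₁ ,
      λ { 0F → Block-refl (apart (λ ()) f₄≡apex) ; 1F → b₁₂ ; 2F → b₁₃ ; 3F → Block-trans b₁₃ b₃₅ }
      where
      b₁₂ : Block (f v₁) (f v₂)
      b₁₂ = block f₄≡apex (λ ()) (λ ()) (Triple-apex f₄≡apex (Triple-rotate T₂))
      b₁₃ : Block (f v₁) (f v₃)
      b₁₃ = block f₄≡apex (λ ()) (λ ()) (Triple-close T₁ (inj₂ (inj₂ b₁₂)))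
      b₃₅ : Block (f v₃) (f v₅)
      b₃₅ = block f₄≡apex (λ ()) (λ ()) (Triple-apex f₄≡apex (Triple-swap₁₂ T₃))

    apex-at-v₅ : f v₅ ≡ apex → InOneBlock v₅
    apex-at-v₅ f₅≡apex with close? (f v₁) (f v₂)
    ... | yes c₁₂ = f v₁ , λ { 0F → Block-refl (apart (λ ()) f₅≡apex) ; 1F → b₁₂ ; 2F → b₁₃ ; 3F → b₁₄ }
      where
      b₁₂ : Block (f v₁) (f v₂)
      b₁₂ = block f₅≡apex (λ ()) (λ ()) c₁₂
      b₁₃ : Block (f v₁) (f v₃)
      b₁₃ = block f₅≡apex (λ ()) (λ ()) (Triple-close T₁ c₁₂)
      b₁₄ : Block (f v₁) (f v₄)
      b₁₄ = block f₅≡apex (λ ()) (λ ()) (Triple-close T₂ c₁₂)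
    ... | no ¬c₁₂ = contradiction (proj₁ copy (Block-colour⇒≡ b₃₄ same-colour)) λ ()
      where
      b₃₄ : Block (f v₃) (f v₄)
      b₃₄ = block f₅≡apex (λ ()) (λ ()) (Triple-apex f₅≡apex (Triple-rotate T₃))
      same-colour : colour (f v₃) ≡ colour (f v₄)
      same-colour = ZeroSum-unique (Triple-far T₁ ¬c₁₂) (Triple-far T₂ ¬c₁₂)

    apex⇒InOneBlock : ∀ i → f i ≡ apex → InOneBlock i
    apex⇒InOneBlock 0F = apex-at-v₁
    apex⇒InOneBlock 1F = apex-at-v₂
    apex⇒InOneBlock 2F = apex-at-v₃
    apex⇒InOneBlock 3F = apex-at-v₄
    apex⇒InOneBlock 4F = apex-at-v₅

  extremal-no-covering : ¬ HasTCovering extremal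
  extremal-no-covering covering with f , copy , i , fi≡apex ← covering apex
    with _ , in-block ← CopyOfT.apex⇒InOneBlock copy i fi≡apex =
    <-irrefl refl (block-bound (f ∘ punchIn i) (punchIn-injective i _ _ ∘ proj₁ copy) in-block)

-- Lower bound

lower-bound : ∀ m → 4 ≤ m → Σ (ThreeGraph (suc m)) λ G → ¬ HasTCovering G × MinCodeg G (c2Value (suc m))
lower-bound m 4≤m with c2Value-cases (suc m)
... | inj₁ c≡1 rewrite c≡1 = star , star-no-covering , star-min-codeg (≤-trans (s≤s (s≤s z≤n)) 4≤m)
  where open StarGraph m
... | inj₂ (s≤s 10≤m , m%3≡0) with divides k m≡k*3 ← m%n≡0⇒n∣m m 3 m%3≡0
  rewrite c2Value≡2 (s≤s 10≤m) m%3≡0 | m≡k*3 = extremal , extremal-no-covering , extremal-min-codeg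
  where
  open Construction k (*-cancelʳ-< 3 3 k 10≤m)

theorem1 : ∀ (n : ℕ) → 5 ≤ n → IsC2T n (c2Value n)
theorem1 (suc m) 5≤n@(s≤s 4≤m) = lower-bound m 4≤m , upper-bound 5≤n
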